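{- Let $x$ be a sequence of pairwise distinct integers of length $m$, $i\in\{1,\ldots,m-1\}$ and $y=\tau(x,i)$. Define $r$ and $\ell$ as follows: $r=\overleftarrow{PD}_x[i]$ if $x[i]<x[i+1]$ and $\overleftarrow{PD}_x[i]>1$; $r=\overleftarrow{PD}_x[i+1]+1$ if $x[i]>x[i+1]$ and $\overleftarrow{PD}_x[i+1]>0$; $r=m-i+1$ otherwise; $\ell=\overrightarrow{PD}_x[i]$ if $x[i]<x[i+1]$ and $\overrightarrow{PD}_x[i]>0$; $\ell=\overrightarrow{PD}_x[i+1]-1$ if $x[i]>x[i+1]$ and $\overrightarrow{PD}_x[i+1]>1$; $\ell=i$ otherwise. Then for each $j$ with $i+2\le j\le i+r-1$: $\overrightarrow{PD}_y[j]=\overrightarrow{PD}_x[j]-1$ if $\overrightarrow{PD}_x[j]=j-i$; $\overrightarrow{PD}_y[j]=\overrightarrow{PD}_x[j]+1$ if $\overrightarrow{PD}_x[j]=j-i-1$ and $x[i]>x[j]>x[i+1]$; and $\overrightarrow{PD}_y[j]=\overrightarrow{PD}_x[j]$ otherwise. And for each $j$ with $i-\ell+1\le j\le i-1$: $\overleftarrow{PD}_y[j]=\overleftarrow{PD}_x[j]-1$ if $\overleftarrow{PD}_x[j]=i+1-j$; $\overleftarrow{PD}_y[j]=\overleftarrow{PD}_x[j]+1$ if $\overleftarrow{PD}_x[j]=i-j$ and $x[i]<x[j]<x[i+1]$; and $\overleftarrow{PD}_y[j]=\overleftarrow{PD}_x[j]$ otherwise.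
   Context: All sequences consist of pairwise distinct integers. $\tau(x,i)$ exchanges $x[i]$ and $x[i+1]$. $\overrightarrow{PD}_x[h]=h-\max\{j<h: x[j]<x[h]\}$ if such $j$ exists and $0$ otherwise; $\overleftarrow{PD}_x[h]=\min\{j>h: x[j]<x[h]\}-h$ if such $j$ exists and $0$ otherwise. -}

module Defs where

open import Data.Nat using (ℕ; zero; suc; _+_; _∸_; _≟_; _<ᵇ_)
open import Data.Integer using (ℤ) renaming (_<?_ to _<ℤ?_)
open import Relation.Nullary using (yes; no)
open import Data.Bool using (true; false; if_then_else_)

-- A sequence of length m is a function x : ℕ → ℤ, whose entries are
-- x 1, …, x m (1-indexed, as in the paper); values outside 1..m are ignored.

-- Forward previous-smaller distance:
-- PDf m x h = h - max{ j : 1 ≤ j < h, x j < x h }, or 0 if no such j.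
-- (Search j = h-1, h-2, …, 1; the first hit is the maximum.)
PDf : ℕ → (ℕ → ℤ) → ℕ → ℕ
PDf m x h = go (h ∸ 1)
  where
  go : ℕ → ℕ
  go zero = zero
  go (suc j) with x (suc j) <ℤ? x h
  ... | yes _ = h ∸ suc j
  ... | no _  = go j

-- Backward next-smaller distance:
-- PDb m x h = min{ j : h < j ≤ m, x j < x h } - h, or 0 if no such j.
-- (Search offsets d = 1, 2, …, m - h; the first hit is the minimum.)
PDb : ℕ → (ℕ → ℤ) → ℕ → ℕ
PDb m x h = go 1 (m ∸ h)
  where
  go : ℕ → ℕ → ℕ
  go d zero = zero
  go d (suc f) with x (h + d) <ℤ? x h
  ... | yes _ = d
  ... | no _  = go (suc d) f

τ : (ℕ → ℤ) → ℕ → (ℕ → ℤ)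
τ x i k with k ≟ i | k ≟ suc i
... | yes _ | _     = x (suc i)
... | no _  | yes _ = x i
... | no _  | no _  = x k

rVal : ℕ → (ℕ → ℤ) → ℕ → ℕ
rVal m x i with x i <ℤ? x (suc i)
... | yes _ = if 1 <ᵇ PDb m x i then PDb m x i else suc (m ∸ i)
... | no _  = if 0 <ᵇ PDb m x (suc i) then suc (PDb m x (suc i)) else suc (m ∸ i)

ℓVal : ℕ → (ℕ → ℤ) → ℕ → ℕ
ℓVal m x i with x i <ℤ? x (suc i)
... | yes _ = if 0 <ᵇ PDf m x i then PDf m x i else i
... | no _  = if 1 <ᵇ PDf m x (suc i) then PDf m x (suc i) ∸ 1 else i

{-# OPTIONS --safe #-}
-- PDf_x[j] and PDb_x[j] are first-hit searches: scan the entries at distance d = 1, 2, …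
-- from j (leftwards, resp. rightwards) and stop at the first one smaller than x[j].  For j
-- outside {i, i+1}, τ(x,i) exchanges two consecutive entries u, w of this scan, at distances
-- p and p+1 (p = j-i-1, resp. p = i-j).  Such an exchange moves the first hit only when the
-- hit is at one of them: a hit at p+1 moves to p, a hit at p moves to p+1 exactly when
-- u < x[j] < w (distinctness rules out w = x[j]), and otherwise the hit stays put.  The
-- bounds r and ℓ only serve to keep j between 1 and m.
module Submission where

open import Defs
open import Data.Nat using (ℕ; zero; suc; _+_; _∸_; _≤_; _<_; z≤n; s≤s; z<s; _≤?_; _≟_; _<ᵇ_)
open import Data.Nat.Properties
open import Data.Integer using (ℤ) renaming (_<_ to _<ℤ_; _<?_ to _<ℤ?_)
import Data.Integer.Properties as ℤ
open import Data.Product using (_×_; _,_)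
open import Data.Sum using (_⊎_; inj₁; inj₂)
open import Data.Bool using (true; false; if_then_else_)
open import Function using (_∘_)
open import Relation.Nullary using (¬_; yes; no; contradiction)
open import Relation.Binary.PropositionalEquality
  using (_≡_; _≢_; refl; sym; trans; cong; subst; ≢-sym; module ≡-Reasoning)

∸-preimage : ∀ {j e k} → 0 < k → j ∸ e ≡ k → e ≡ j ∸ k
∸-preimage {j} {e} 0<k j∸e≡k with e ≤? j
... | yes e≤j = trans (sym (m∸[m∸n]≡n e≤j)) (cong (j ∸_) j∸e≡k)
... | no e≰j  = contradiction (trans (sym (m≤n⇒m∸n≡0 (<⇒≤ (≰⇒> e≰j)))) j∸e≡k) (<⇒≢ 0<k)

+-preimage : ∀ j {e k} → j + e ≡ k → e ≡ k ∸ j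
+-preimage j {e} j+e≡k = trans (sym (m+n∸m≡n j e)) (cong (_∸ j) j+e≡k)

search : (ℕ → ℤ) → ℤ → ℕ → ℕ → ℕ
search s v d zero = zero
search s v d (suc f) with s d <ℤ? v
... | yes _ = d
... | no _  = search s v (suc d) f

module _ (s : ℕ → ℤ) {v : ℤ} (d : ℕ) where

  search-hit : ∀ f → s d <ℤ v → search s v d (suc f) ≡ d
  search-hit f p with s d <ℤ? v
  ... | yes _ = refl
  ... | no ¬p = contradiction p ¬p

  search-miss : ∀ f → ¬ s d <ℤ v → search s v d (suc f) ≡ search s v (suc d) f
  search-miss f ¬p with s d <ℤ? v
  ... | yes p = contradiction p ¬p
  ... | no _  = refl

search-bounds : ∀ s v d f →
  search s v d f ≡ 0 ⊎ (d ≤ search s v d f × search s v d f < d + f)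
search-bounds s v d zero = inj₁ refl
search-bounds s v d (suc f) with s d <ℤ? v
... | yes _ = inj₂ (≤-refl , m<m+n d z<s)
... | no _ with search-bounds s v (suc d) f
...   | inj₁ none        = inj₁ none
...   | inj₂ (d<e , e<)  = inj₂ (<⇒≤ d<e , subst (search s v (suc d) f <_) (sym (+-suc d f)) e<)

search-≤ : ∀ s v f → search s v 1 f ≤ f
search-≤ s v f with search-bounds s v 1 f
... | inj₁ none     = subst (_≤ f) (sym none) z≤n
... | inj₂ (_ , e<) = ≤-pred e<

search-cong : ∀ {s s' v} d f → (∀ e → d ≤ e → s' e ≡ s e) → search s' v d f ≡ search s v d f
search-cong d zero eq = refl
search-cong {s} {s'} {v} d (suc f) eq with s d <ℤ? v | s' d <ℤ? v
... | yes _ | yes _  = refl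
... | no _  | no _   = search-cong (suc d) f (λ e d<e → eq e (<⇒≤ d<e))
... | yes p | no ¬p' = contradiction (subst (_<ℤ v) (sym (eq d ≤-refl)) p) ¬p'
... | no ¬p | yes p' = contradiction (subst (_<ℤ v) (eq d ≤-refl) p') ¬p

record Swapped {A : Set} (s s' : ℕ → A) (a b : ℕ) : Set where
  field
    at-fst    : s' a ≡ s b
    at-snd    : s' b ≡ s a
    elsewhere : ∀ e → e ≢ a → e ≢ b → s' e ≡ s e

open Swapped

Swapped-sym : ∀ {A : Set} {s s' : ℕ → A} {a b} → Swapped s s' a b → Swapped s s' b a
Swapped-sym sw = record
  { at-fst = at-snd sw ; at-snd = at-fst sw ; elsewhere = λ e e≢b e≢a → elsewhere sw e e≢a e≢b }

Swapped-reindex : ∀ {A : Set} {s s' : ℕ → A} {p q a b} (pos : ℕ → ℕ) → Swapped s s' p q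
  → pos a ≡ p → pos b ≡ q → (∀ e → pos e ≡ p → e ≡ a) → (∀ e → pos e ≡ q → e ≡ b)
  → Swapped (s ∘ pos) (s' ∘ pos) a b
Swapped-reindex {s = s} {s' = s'} pos sw pa pb only-a only-b = record
  { at-fst    = trans (cong s' pa) (trans (at-fst sw) (cong s (sym pb)))
  ; at-snd    = trans (cong s' pb) (trans (at-snd sw) (cong s (sym pa)))
  ; elsewhere = λ e e≢a e≢b → elsewhere sw (pos e) (e≢a ∘ only-a e) (e≢b ∘ only-b e)
  }

-- How the first hit moves, from old to new, when the entries u and w at p and p+1 of a scan
-- for entries below v are exchanged.
data SwapOutcome (p : ℕ) (u w v : ℤ) : (old new : ℕ) → Set where
  moved-down : SwapOutcome p u w v (suc p) p
  moved-up   : u <ℤ v → v <ℤ w → SwapOutcome p u w v p (suc p)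
  unchanged  : ∀ {n} → n ≢ suc p → ¬ (n ≡ p × u <ℤ v × v <ℤ w) → SwapOutcome p u w v n n

SwapOutcome-cong : ∀ {p u u' w w' v old old' new new'}
  → u ≡ u' → w ≡ w' → old ≡ old' → new ≡ new'
  → SwapOutcome p u w v old new → SwapOutcome p u' w' v old' new'
SwapOutcome-cong refl refl refl refl o = o

SwapLaw : (old new p q : ℕ) (u w v : ℤ) → Set
SwapLaw old new p q u w v =
    (old ≡ q → new ≡ old ∸ 1)
  × (old ≡ p → u <ℤ v → v <ℤ w → new ≡ suc old)
  × (old ≢ q → ¬ (old ≡ p × u <ℤ v × v <ℤ w) → new ≡ old)

swap-law : ∀ {old new p q u w v} → q ≡ suc p → SwapOutcome p u w v old new
  → SwapLaw old new p q u w v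
swap-law refl moved-down =
    (λ _ → refl)
  , (λ 1+p≡p → contradiction 1+p≡p 1+n≢n)
  , (λ ≢refl → contradiction refl ≢refl)
swap-law refl (moved-up u<v v<w) =
    (λ p≡1+p → contradiction (sym p≡1+p) 1+n≢n)
  , (λ _ _ _ → refl)
  , (λ _ ¬up → contradiction (refl , u<v , v<w) ¬up)
swap-law refl (unchanged n≢1+p ¬up) =
    (λ n≡1+p → contradiction n≡1+p n≢1+p)
  , (λ n≡p u<v v<w → contradiction (n≡p , u<v , v<w) ¬up)
  , (λ _ _ → refl)

module _ {s s' : ℕ → ℤ} {v : ℤ} {a : ℕ} (sw : Swapped s s' a (suc a)) (w≢v : s (suc a) ≢ v) where

  private
    <v-subst : ∀ {t t'} → t ≡ t' → t <ℤ v → t' <ℤ v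
    <v-subst = subst (_<ℤ v)

    Outcome : ℕ → ℕ → Set
    Outcome = SwapOutcome a (s a) (s (suc a)) v

  search-swap-at : ∀ f → SwapOutcome a (s a) (s (suc a)) v
    (search s v a (suc (suc f))) (search s' v a (suc (suc f)))
  search-swap-at f with s a <ℤ? v
  ... | yes u<v with s (suc a) <ℤ? v
  ...   | yes w<v = subst (Outcome a)
          (sym (search-hit s' a (suc f) (<v-subst (sym (at-fst sw)) w<v)))
          (unchanged (<⇒≢ (n<1+n a)) (λ (_ , _ , v<w) → ℤ.<-asym w<v v<w))
  ...   | no w≮v = subst (Outcome a)
          (sym (trans (search-miss s' a (suc f) (w≮v ∘ <v-subst (at-fst sw)))
                      (search-hit s' (suc a) f (<v-subst (sym (at-snd sw)) u<v))))
          (moved-up u<v (ℤ.≤∧≢⇒< (ℤ.≮⇒≥ w≮v) (≢-sym w≢v)))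
  search-swap-at f | no u≮v with s (suc a) <ℤ? v
  ...   | yes w<v = subst (Outcome (suc a))
          (sym (search-hit s' a (suc f) (<v-subst (sym (at-fst sw)) w<v)))
          moved-down
  ...   | no w≮v = subst (Outcome (search s v (suc (suc a)) f))
          (sym (trans (search-miss s' a (suc f) (w≮v ∘ <v-subst (at-fst sw)))
                 (trans (search-miss s' (suc a) f (u≮v ∘ <v-subst (at-snd sw)))
                        (search-cong (suc (suc a)) f beyond))))
          (unchanged rest≢1+a (λ (_ , u<v , _) → u≮v u<v))
    where
    beyond : ∀ e → suc (suc a) ≤ e → s' e ≡ s e
    beyond e 2+a≤e = elsewhere sw e (<⇒≢ (<-trans (n<1+n a) 2+a≤e) ∘ sym) (<⇒≢ 2+a≤e ∘ sym)

    rest≢1+a : search s v (suc (suc a)) f ≢ suc a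
    rest≢1+a with search-bounds s v (suc (suc a)) f
    ... | inj₁ none       = λ e → 0≢1+n (trans (sym none) e)
    ... | inj₂ (2+a≤e , _) = λ e → <⇒≢ 2+a≤e (sym e)

  search-swap : ∀ d f → d ≤ a → suc a < d + f
    → SwapOutcome a (s a) (s (suc a)) v (search s v d f) (search s' v d f)
  search-swap d f d≤a 1+a<d+f with m≤n⇒m<n∨m≡n d≤a
  search-swap d zero d≤a 1+a<d+0 | _ =
    contradiction 1+a<d+0 (≤⇒≯ (≤-trans (≤-reflexive (+-identityʳ d)) (m≤n⇒m≤1+n d≤a)))
  search-swap d (suc f) d≤a 1+a<d+f | inj₁ d<a
    with elsewhere sw d (<⇒≢ d<a) (<⇒≢ (m<n⇒m<1+n d<a)) | s d <ℤ? v
  ... | s'd≡sd | yes u<v = subst (Outcome d)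
          (sym (search-hit s' d f (<v-subst (sym s'd≡sd) u<v)))
          (unchanged (<⇒≢ (m<n⇒m<1+n d<a)) (λ (d≡a , _) → <⇒≢ d<a d≡a))
  ... | s'd≡sd | no u≮v = subst (Outcome (search s v (suc d) f))
          (sym (search-miss s' d f (u≮v ∘ <v-subst s'd≡sd)))
          (search-swap (suc d) f d<a (subst (suc a <_) (+-suc d f) 1+a<d+f))
  search-swap a (suc zero) _ 1+a<a+1 | inj₂ refl =
    contradiction 1+a<a+1 (≤⇒≯ (≤-reflexive (+-comm a 1)))
  search-swap a (suc (suc f)) _ _ | inj₂ refl = search-swap-at f

τ-swapped : ∀ x i → Swapped x (τ x i) i (suc i)
τ-swapped x i = record { at-fst = at-i ; at-snd = at-suc-i ; elsewhere = at-other }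
  where
  at-i : τ x i i ≡ x (suc i)
  at-i with i ≟ i
  ... | yes _   = refl
  ... | no i≢i  = contradiction refl i≢i

  at-suc-i : τ x i (suc i) ≡ x i
  at-suc-i with suc i ≟ i | suc i ≟ suc i
  ... | yes 1+i≡i | _        = contradiction 1+i≡i 1+n≢n
  ... | no _      | yes _    = refl
  ... | no _      | no ≢refl = contradiction refl ≢refl

  at-other : ∀ k → k ≢ i → k ≢ suc i → τ x i k ≡ x k
  at-other k k≢i k≢1+i with k ≟ i | k ≟ suc i
  ... | yes k≡i | _         = contradiction k≡i k≢i
  ... | no _    | yes k≡1+i = contradiction k≡1+i k≢1+i
  ... | no _    | no _      = refl

-- The scans `go` local to PDf and PDb are not exported by Defs.  Each hole below is solved by
-- unification against the equation that follows it, which thereby gives the scan a name.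
mutual
  PDf-scan : ℕ → (ℕ → ℤ) → ℕ → ℕ → ℕ
  PDf-scan m x h = _

  PDf-unfold : ∀ m x h → PDf m x h ≡ PDf-scan m x h (h ∸ 1)
  PDf-unfold m x h with h ∸ 1
  ... | n = refl

mutual
  PDb-scan : ℕ → (ℕ → ℤ) → ℕ → ℕ → ℕ → ℕ
  PDb-scan m x h = _

  PDb-unfold : ∀ m x h → PDb m x h ≡ PDb-scan m x h 1 (m ∸ h)
  PDb-unfold m x h with 1 | m ∸ h
  ... | d | f = refl

PDf-scan≡search : ∀ m x h n → n < h
  → PDf-scan m x h n ≡ search (λ d → x (h ∸ d)) (x h) (h ∸ n) n
PDf-scan≡search m x h zero _ = refl
PDf-scan≡search m x h (suc n) n<h with x (suc n) <ℤ? x h | cong x (m∸[m∸n]≡n (<⇒≤ n<h))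
... | yes p | x-at = sym (search-hit s (h ∸ suc n) n (subst (_<ℤ x h) (sym x-at) p))
  where s = λ d → x (h ∸ d)
... | no ¬p | x-at = begin
  PDf-scan m x h n                     ≡⟨ PDf-scan≡search m x h n (<⇒≤ n<h) ⟩
  search s (x h) (h ∸ n) n             ≡⟨ cong (λ d → search s (x h) d n) (+-∸-assoc 1 (<⇒≤ n<h)) ⟩
  search s (x h) (suc (h ∸ suc n)) n   ≡⟨ search-miss s (h ∸ suc n) n (¬p ∘ subst (_<ℤ x h) x-at) ⟨
  search s (x h) (h ∸ suc n) (suc n)   ∎
  where
  open ≡-Reasoning
  s = λ d → x (h ∸ d)

PDf-search : ∀ m x h → PDf m x h ≡ search (λ d → x (h ∸ d)) (x h) 1 (h ∸ 1)
PDf-search m x zero = refl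
PDf-search m x (suc h) = begin
  PDf m x (suc h)                  ≡⟨ PDf-unfold m x (suc h) ⟩
  PDf-scan m x (suc h) h           ≡⟨ PDf-scan≡search m x (suc h) h ≤-refl ⟩
  search s (x (suc h)) (suc h ∸ h) h ≡⟨ cong (λ d → search s (x (suc h)) d h) (m+n∸n≡m 1 h) ⟩
  search s (x (suc h)) 1 h         ∎
  where
  open ≡-Reasoning
  s = λ d → x (suc h ∸ d)

PDb-scan≡search : ∀ m x h d f → PDb-scan m x h d f ≡ search (λ e → x (h + e)) (x h) d f
PDb-scan≡search m x h d zero = refl
PDb-scan≡search m x h d (suc f) with x (h + d) <ℤ? x h
... | yes _ = refl
... | no _  = PDb-scan≡search m x h (suc d) f

PDb-search : ∀ m x h → PDb m x h ≡ search (λ e → x (h + e)) (x h) 1 (m ∸ h)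
PDb-search m x h = trans (PDb-unfold m x h) (PDb-scan≡search m x h 1 (m ∸ h))

PDf-swap : ∀ m x {i j} → 1 ≤ i → i + 2 ≤ j → x i ≢ x j
  → SwapLaw (PDf m x j) (PDf m (τ x i) j) (j ∸ i ∸ 1) (j ∸ i) (x (suc i)) (x i) (x j)
PDf-swap m x {i} {j} 1≤i i+2≤j xi≢xj = swap-law (sym 1+a≡j∸i)
  (SwapOutcome-cong (cong x j∸a≡1+i) (cong x j∸[1+a]≡i) (sym (PDf-search m x j)) (sym new≡)
    (search-swap sw (xi≢xj ∘ trans (cong x (sym j∸[1+a]≡i))) 1 (j ∸ 1) 1≤a window))
  where
  a = j ∸ i ∸ 1
  s' = λ d → τ x i (j ∸ d)
  1+i<j : suc i < j
  1+i<j = subst (_≤ j) (+-comm i 2) i+2≤j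
  i<j : i < j
  i<j = <⇒≤ 1+i<j
  a≡j∸[1+i] : a ≡ j ∸ suc i
  a≡j∸[1+i] = trans (∸-+-assoc j i 1) (cong (j ∸_) (+-comm i 1))
  1+a≡j∸i : suc a ≡ j ∸ i
  1+a≡j∸i = trans (cong suc a≡j∸[1+i]) (sym (+-∸-assoc 1 i<j))
  j∸a≡1+i : j ∸ a ≡ suc i
  j∸a≡1+i = trans (cong (j ∸_) a≡j∸[1+i]) (m∸[m∸n]≡n i<j)
  j∸[1+a]≡i : j ∸ suc a ≡ i
  j∸[1+a]≡i = trans (cong (j ∸_) 1+a≡j∸i) (m∸[m∸n]≡n (<⇒≤ i<j))
  1≤a : 1 ≤ a
  1≤a = subst (1 ≤_) (sym a≡j∸[1+i]) (m<n⇒0<n∸m 1+i<j)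
  window : suc a < 1 + (j ∸ 1)
  window = s≤s (subst (_≤ j ∸ 1) (sym 1+a≡j∸i) (∸-monoʳ-≤ j 1≤i))
  sw : Swapped (λ d → x (j ∸ d)) s' a (suc a)
  sw = Swapped-reindex (j ∸_) (Swapped-sym (τ-swapped x i)) j∸a≡1+i j∸[1+a]≡i
         (λ e j∸e≡1+i → trans (∸-preimage z<s j∸e≡1+i) (sym a≡j∸[1+i]))
         (λ e j∸e≡i → trans (∸-preimage 1≤i j∸e≡i) (sym 1+a≡j∸i))
  new≡ : PDf m (τ x i) j ≡ search s' (x j) 1 (j ∸ 1)
  new≡ = trans (PDf-search m (τ x i) j)
           (cong (λ v → search s' v 1 (j ∸ 1)) (elsewhere (τ-swapped x i) j (>⇒≢ i<j) (>⇒≢ 1+i<j)))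

PDb-swap : ∀ m x {i j} → j < i → suc i ≤ m → x (suc i) ≢ x j
  → SwapLaw (PDb m x j) (PDb m (τ x i) j) (i ∸ j) (suc i ∸ j) (x i) (x (suc i)) (x j)
PDb-swap m x {i} {j} j<i i<m x[1+i]≢xj = swap-law (sym 1+a≡1+i∸j)
  (SwapOutcome-cong (cong x j+a≡i) (cong x j+[1+a]≡1+i) (sym (PDb-search m x j)) (sym new≡)
    (search-swap sw (x[1+i]≢xj ∘ trans (cong x (sym j+[1+a]≡1+i))) 1 (m ∸ j) 1≤a window))
  where
  a = i ∸ j
  s' = λ e → τ x i (j + e)
  1+a≡1+i∸j : suc a ≡ suc i ∸ j
  1+a≡1+i∸j = sym (+-∸-assoc 1 (<⇒≤ j<i))
  j+a≡i : j + a ≡ i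
  j+a≡i = m+[n∸m]≡n (<⇒≤ j<i)
  j+[1+a]≡1+i : j + suc a ≡ suc i
  j+[1+a]≡1+i = trans (+-suc j a) (cong suc j+a≡i)
  1≤a : 1 ≤ a
  1≤a = m<n⇒0<n∸m j<i
  window : suc a < 1 + (m ∸ j)
  window = s≤s (subst (_≤ m ∸ j) (sym 1+a≡1+i∸j) (∸-monoˡ-≤ j i<m))
  sw : Swapped (λ e → x (j + e)) s' a (suc a)
  sw = Swapped-reindex (j +_) (τ-swapped x i) j+a≡i j+[1+a]≡1+i
         (λ e j+e≡i → +-preimage j j+e≡i)
         (λ e j+e≡1+i → trans (+-preimage j j+e≡1+i) (sym 1+a≡1+i∸j))
  new≡ : PDb m (τ x i) j ≡ search s' (x j) 1 (m ∸ j)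
  new≡ = trans (PDb-search m (τ x i) j)
           (cong (λ v → search s' v 1 (m ∸ j))
                 (elsewhere (τ-swapped x i) j (<⇒≢ j<i) (<⇒≢ (m<n⇒m<1+n j<i))))

if-intro : ∀ {A : Set} {P : A → Set} b {t e} → P t → P e → P (if b then t else e)
if-intro true  pt _  = pt
if-intro false _  pe = pe

PDf≤h∸1 : ∀ m x h → PDf m x h ≤ h ∸ 1
PDf≤h∸1 m x h = subst (_≤ h ∸ 1) (sym (PDf-search m x h)) (search-≤ _ _ (h ∸ 1))

PDb≤m∸h : ∀ m x h → PDb m x h ≤ m ∸ h
PDb≤m∸h m x h = subst (_≤ m ∸ h) (sym (PDb-search m x h)) (search-≤ _ _ (m ∸ h))

rVal≤1+m∸i : ∀ m x i → rVal m x i ≤ suc (m ∸ i)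
rVal≤1+m∸i m x i with x i <ℤ? x (suc i)
... | yes _ = if-intro {P = _≤ suc (m ∸ i)} (1 <ᵇ PDb m x i) (m≤n⇒m≤1+n (PDb≤m∸h m x i)) ≤-refl
... | no _  = if-intro {P = _≤ suc (m ∸ i)} (0 <ᵇ PDb m x (suc i))
                (s≤s (≤-trans (PDb≤m∸h m x (suc i)) (∸-monoʳ-≤ m (n≤1+n i)))) ≤-refl

ℓVal≤i : ∀ m x i → ℓVal m x i ≤ i
ℓVal≤i m x i with x i <ℤ? x (suc i)
... | yes _ = if-intro {P = _≤ i} (0 <ᵇ PDf m x i) (≤-trans (PDf≤h∸1 m x i) (m∸n≤m i 1)) ≤-refl
... | no _  = if-intro {P = _≤ i} (1 <ᵇ PDf m x (suc i))
                (≤-trans (m∸n≤m (PDf m x (suc i)) 1) (PDf≤h∸1 m x (suc i))) ≤-refl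

lemma10 : (m : ℕ) (x : ℕ → ℤ)
    → (∀ a b → 1 ≤ a → a ≤ m → 1 ≤ b → b ≤ m → a ≢ b → x a ≢ x b)
    → (i : ℕ) → 1 ≤ i → suc i ≤ m
    → ((j : ℕ) → i + 2 ≤ j → suc j ≤ i + rVal m x i
        → (PDf m x j ≡ j ∸ i → PDf m (τ x i) j ≡ PDf m x j ∸ 1)
        × (PDf m x j ≡ j ∸ i ∸ 1 → x (suc i) <ℤ x j → x j <ℤ x i
             → PDf m (τ x i) j ≡ suc (PDf m x j))
        × (PDf m x j ≢ j ∸ i
             → ¬ (PDf m x j ≡ j ∸ i ∸ 1 × x (suc i) <ℤ x j × x j <ℤ x i)
             → PDf m (τ x i) j ≡ PDf m x j))
    × ((j : ℕ) → i + 1 ≤ j + ℓVal m x i → suc j ≤ i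
        → (PDb m x j ≡ suc i ∸ j → PDb m (τ x i) j ≡ PDb m x j ∸ 1)
        × (PDb m x j ≡ i ∸ j → x i <ℤ x j → x j <ℤ x (suc i)
             → PDb m (τ x i) j ≡ suc (PDb m x j))
        × (PDb m x j ≢ suc i ∸ j
             → ¬ (PDb m x j ≡ i ∸ j × x i <ℤ x j × x j <ℤ x (suc i))
             → PDb m (τ x i) j ≡ PDb m x j))
lemma10 m x distinct i 1≤i i<m =
    (λ j i+2≤j j<i+r → let i<j = <-≤-trans (m<m+n i z<s) i+2≤j in
       PDf-swap m x 1≤i i+2≤j
         (distinct i j 1≤i (<⇒≤ i<m) (≤-trans 1≤i (<⇒≤ i<j)) (j≤m j<i+r) (<⇒≢ i<j)))
  , (λ j i<j+ℓ j<i →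
       PDb-swap m x j<i i<m
         (distinct (suc i) j z<s i<m (1≤j i<j+ℓ) (≤-trans (<⇒≤ j<i) (<⇒≤ i<m))
           (>⇒≢ (m<n⇒m<1+n j<i))))
  where
  j≤m : ∀ {j} → suc j ≤ i + rVal m x i → j ≤ m
  j≤m {j} j<i+r = ≤-pred (begin
    suc j              ≤⟨ j<i+r ⟩
    i + rVal m x i     ≤⟨ +-monoʳ-≤ i (rVal≤1+m∸i m x i) ⟩
    i + suc (m ∸ i)    ≡⟨ +-suc i (m ∸ i) ⟩
    suc (i + (m ∸ i))  ≡⟨ cong suc (m+[n∸m]≡n (<⇒≤ i<m)) ⟩
    suc m              ∎)
    where open ≤-Reasoning

  1≤j : ∀ {j} → i + 1 ≤ j + ℓVal m x i → 1 ≤ j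
  1≤j {zero}  i+1≤ℓ = contradiction (≤-trans i+1≤ℓ (ℓVal≤i m x i)) (m+1+n≰m i)
  1≤j {suc j} _     = s≤s z≤n
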